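{- Let $E$ be a propositional variable and $\delta$ a new atomic formula symbol (the fixed point operator of $A(p,E)=(\exists x)x:\neg p\vee(E\wedge\neg(\exists x)x:(p\rightarrow E))$). The logic $\mathsf{QLP}(\delta\leftrightarrow[(\exists x)x:\neg\delta\vee(E\wedge\neg(\exists x)x:(\delta\rightarrow E))])_{\emptyset}$, i.e. $\mathsf{QLP}$ without Axiom Necessitation, over the language extended by $\delta$, with this single additional axiom, is inconsistent.
   Context: Fix countably many justification variables, propositional variables, and primitive function symbols of each arity $n\ge0$; a primitive term is $f(x_1,\dots,x_n)$. Terms of $\mathsf{QLP}$: $t::= x\mid f(x_1,\dots,x_n)\mid t\cdot t\mid t+t\mid !t\mid(t\forall x)$ ($x$ bound in $(t\forall x)$). Formulas: $A::= p\mid\bot\mid\neg A\mid A\wedge A\mid A\vee A\mid A\rightarrow A\mid t:A\mid(\forall x)A\mid(\exists x)A$. Axioms: all propositional tautologies; Q1: $(\forall x)A(x)\rightarrow A(t)$, $t$ free for $x$; Q2: $(\forall x)(A\rightarrow B(x))\rightarrow(A\rightarrow(\forall x)B(x))$, $x$ not free in $A$; Q3: $A(t)\rightarrow(\exists x)A(x)$, $t$ free for $x$; Q4: $(\forall x)(A(x)\rightarrow B)\rightarrow((\exists x)A(x)\rightarrow B)$, $x$ not free in $B$; jK: $s:(A\rightarrow B)\rightarrow(t:A\rightarrow(s\cdot t):B)$; jT: $t:A\rightarrow A$; j4: $t:A\rightarrow !t:t:A$; Sum: $s:A\rightarrow(s+t):A$, $s:A\rightarrow(t+s):A$; UF: $(\exists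 y)y:(\forall x)t:A\rightarrow(t\forall x):(\forall x)A$, $y$ not free in $t$ or $A$. Rules: Modus Ponens; Gen: from $A$ infer $(\forall x)A$; qNec: from $A$ infer $(\exists x)x:A$, $x$ not free in $A$; Axiom Necessitation: from an axiom instance $A$ infer $f(x_1,\dots,x_n):A$. The subscript $\emptyset$ means Axiom Necessitation is dropped. All schemes and rules apply to formulas of the extended language. -}

module Defs where

open import Data.Nat using (ℕ; _≡ᵇ_)
open import Data.Bool using (Bool; true; false; if_then_else_; _∧_; _∨_; not)
open import Data.Maybe using (Maybe; just; nothing)
import Data.Maybe as M
open import Data.Vec using (Vec; []; _∷_)
open import Data.Vec.Relation.Unary.Any using (Any)
open import Data.Product using (_×_)
open import Data.Sum using (_⊎_)
open import Data.Unit using (⊤)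
open import Relation.Nullary using (¬_)
open import Relation.Binary.PropositionalEquality using (_≡_; _≢_)

infixl 7 _·_
infixl 6 _⊕_
infixr 2 _⇒_
infixr 3 _∨'_
infixr 4 _∧'_
infixr 5 _∶_
infix 6 ¬'_
infix 8 !_

data Term : Set where
  jv   : ℕ → Term
  fn   : (n : ℕ) → ℕ → Vec ℕ n → Term      -- primitive term f(x1,...,xn), f the i-th symbol of arity n
  _·_  : Term → Term → Term
  _⊕_  : Term → Term → Term
  !_   : Term → Term
  _∀ᵗ_ : Term → ℕ → Term

data Formula : Set where
  pv    : ℕ → Formula
  δ     : Formula
  ⊥'    : Formula
  ¬'_   : Formula → Formula
  _∧'_  : Formula → Formula → Formula
  _∨'_  : Formula → Formula → Formula
  _⇒_   : Formula → Formula → Formula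
  _∶_   : Term → Formula → Formula
  ∀'    : ℕ → Formula → Formula
  ∃'    : ℕ → Formula → Formula

data FreeT (x : ℕ) : Term → Set where
  var  : ∀ {y} → x ≡ y → FreeT x (jv y)
  fn   : ∀ {n i ys} → Any (x ≡_) ys → FreeT x (fn n i ys)
  appˡ : ∀ {s t} → FreeT x s → FreeT x (s · t)
  appʳ : ∀ {s t} → FreeT x t → FreeT x (s · t)
  sumˡ : ∀ {s t} → FreeT x s → FreeT x (s ⊕ t)
  sumʳ : ∀ {s t} → FreeT x t → FreeT x (s ⊕ t)
  bang : ∀ {t} → FreeT x t → FreeT x (! t)
  uall : ∀ {t y} → x ≢ y → FreeT x t → FreeT x (t ∀ᵗ y)

data Free (x : ℕ) : Formula → Set where
  neg   : ∀ {A} → Free x A → Free x (¬' A)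
  andˡ  : ∀ {A B} → Free x A → Free x (A ∧' B)
  andʳ  : ∀ {A B} → Free x B → Free x (A ∧' B)
  orˡ   : ∀ {A B} → Free x A → Free x (A ∨' B)
  orʳ   : ∀ {A B} → Free x B → Free x (A ∨' B)
  impˡ  : ∀ {A B} → Free x A → Free x (A ⇒ B)
  impʳ  : ∀ {A B} → Free x B → Free x (A ⇒ B)
  justᵗ : ∀ {t A} → FreeT x t → Free x (t ∶ A)
  justᶠ : ∀ {t A} → Free x A → Free x (t ∶ A)
  all   : ∀ {y A} → x ≢ y → Free x A → Free x (∀' y A)
  ex    : ∀ {y A} → x ≢ y → Free x A → Free x (∃' y A)

-- Since arguments of primitive terms f(x1,...,xn) must be variables,
-- the result is undefined (nothing) when a non-variable term would have
-- to be placed in such an argument position.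

substArgs : ∀ {n} → ℕ → Term → Vec ℕ n → Maybe (Vec ℕ n)
substArgs x s [] = just []
substArgs x s (y ∷ ys) with x ≡ᵇ y
... | false = M.map (y ∷_) (substArgs x s ys)
... | true with s
...   | jv z = M.map (z ∷_) (substArgs x s ys)
...   | _    = nothing

substT : ℕ → Term → Term → Maybe Term
substT x s (jv y) = if x ≡ᵇ y then just s else just (jv y)
substT x s (fn n i ys) = M.map (fn n i) (substArgs x s ys)
substT x s (t · u) = M.zipWith _·_ (substT x s t) (substT x s u)
substT x s (t ⊕ u) = M.zipWith _⊕_ (substT x s t) (substT x s u)
substT x s (! t) = M.map !_ (substT x s t)
substT x s (t ∀ᵗ y) = if x ≡ᵇ y then just (t ∀ᵗ y) else M.map (_∀ᵗ y) (substT x s t)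

subst : ℕ → Term → Formula → Maybe Formula
subst x s (pv p) = just (pv p)
subst x s δ = just δ
subst x s ⊥' = just ⊥'
subst x s (¬' A) = M.map ¬'_ (subst x s A)
subst x s (A ∧' B) = M.zipWith _∧'_ (subst x s A) (subst x s B)
subst x s (A ∨' B) = M.zipWith _∨'_ (subst x s A) (subst x s B)
subst x s (A ⇒ B) = M.zipWith _⇒_ (subst x s A) (subst x s B)
subst x s (t ∶ A) = M.zipWith _∶_ (substT x s t) (subst x s A)
subst x s (∀' y A) = if x ≡ᵇ y then just (∀' y A) else M.map (∀' y) (subst x s A)
subst x s (∃' y A) = if x ≡ᵇ y then just (∃' y A) else M.map (∃' y) (subst x s A)

FreeForT : Term → ℕ → Term → Set
FreeForT s x (jv y) = ⊤
FreeForT s x (fn n i ys) = ⊤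
FreeForT s x (t · u) = FreeForT s x t × FreeForT s x u
FreeForT s x (t ⊕ u) = FreeForT s x t × FreeForT s x u
FreeForT s x (! t) = FreeForT s x t
FreeForT s x (t ∀ᵗ y) = ¬ FreeT x (t ∀ᵗ y) ⊎ (¬ FreeT y s × FreeForT s x t)

FreeFor : Term → ℕ → Formula → Set
FreeFor s x (pv p) = ⊤
FreeFor s x δ = ⊤
FreeFor s x ⊥' = ⊤
FreeFor s x (¬' A) = FreeFor s x A
FreeFor s x (A ∧' B) = FreeFor s x A × FreeFor s x B
FreeFor s x (A ∨' B) = FreeFor s x A × FreeFor s x B
FreeFor s x (A ⇒ B) = FreeFor s x A × FreeFor s x B
FreeFor s x (t ∶ A) = FreeForT s x t × FreeFor s x A
FreeFor s x (∀' y A) = ¬ Free x (∀' y A) ⊎ (¬ FreeT y s × FreeFor s x A)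
FreeFor s x (∃' y A) = ¬ Free x (∃' y A) ⊎ (¬ FreeT y s × FreeFor s x A)

-- Propositional tautologies (instances in the extended language):
-- formulas true under every Boolean valuation of their maximal
-- non-connective subformulas (variables, δ, t:A, (∀x)A, (∃x)A).

eval : (Formula → Bool) → Formula → Bool
eval v ⊥' = false
eval v (¬' A) = not (eval v A)
eval v (A ∧' B) = eval v A ∧ eval v B
eval v (A ∨' B) = eval v A ∨ eval v B
eval v (A ⇒ B) = not (eval v A) ∨ eval v B
eval v A = v A

Tautology : Formula → Set
Tautology A = (v : Formula → Bool) → eval v A ≡ true

data QLP∅ (Ax : Formula → Set) : Formula → Set where
  taut : ∀ {A} → Tautology A → QLP∅ Ax A
  q1   : ∀ {x t A B} → FreeFor t x A → subst x t A ≡ just B → QLP∅ Ax (∀' x A ⇒ B)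
  q2   : ∀ {x A B} → ¬ Free x A → QLP∅ Ax (∀' x (A ⇒ B) ⇒ (A ⇒ ∀' x B))
  q3   : ∀ {x t A B} → FreeFor t x A → subst x t A ≡ just B → QLP∅ Ax (B ⇒ ∃' x A)
  q4   : ∀ {x A B} → ¬ Free x B → QLP∅ Ax (∀' x (A ⇒ B) ⇒ (∃' x A ⇒ B))
  jK   : ∀ {s t A B} → QLP∅ Ax (s ∶ (A ⇒ B) ⇒ (t ∶ A ⇒ (s · t) ∶ B))
  jT   : ∀ {t A} → QLP∅ Ax (t ∶ A ⇒ A)
  j4   : ∀ {t A} → QLP∅ Ax (t ∶ A ⇒ (! t) ∶ (t ∶ A))
  sumˡ : ∀ {s t A} → QLP∅ Ax (s ∶ A ⇒ (s ⊕ t) ∶ A)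
  sumʳ : ∀ {s t A} → QLP∅ Ax (s ∶ A ⇒ (t ⊕ s) ∶ A)
  uf   : ∀ {x y t A} → ¬ FreeT y t → ¬ Free y A →
         QLP∅ Ax (∃' y (jv y ∶ ∀' x (t ∶ A)) ⇒ (t ∀ᵗ x) ∶ ∀' x A)
  ax   : ∀ {A} → Ax A → QLP∅ Ax A
  mp   : ∀ {A B} → QLP∅ Ax (A ⇒ B) → QLP∅ Ax A → QLP∅ Ax B
  gen  : ∀ {x A} → QLP∅ Ax A → QLP∅ Ax (∀' x A)
  qnec : ∀ {x A} → ¬ Free x A → QLP∅ Ax A → QLP∅ Ax (∃' x (jv x ∶ A))

_⇔_ : Formula → Formula → Formula
A ⇔ B = (A ⇒ B) ∧' (B ⇒ A)

-- The fixed-point axiom  δ ↔ [(∃x)x:¬δ ∨ (E ∧ ¬(∃x)x:(δ → E))],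
-- with E the propositional variable number e and x the variable 0.
fixAxiom : ℕ → Formula
fixAxiom e =
  δ ⇔ (∃' 0 (jv 0 ∶ ¬' δ) ∨' (pv e ∧' ¬' ∃' 0 (jv 0 ∶ (δ ⇒ pv e))))

Inconsistent : (Formula → Set) → Set
Inconsistent Ax = QLP∅ Ax ⊥'

module Submission where

open import Defs
open import Data.Nat using (ℕ)
open import Data.Bool using (true; false)
open import Relation.Nullary using (¬_)
open import Relation.Binary.PropositionalEquality using (_≡_; refl)

-- Write X = (∃x)x:¬δ and Y = (∃x)x:(δ → E), so that the
-- fixed-point axiom reads  δ ↔ X ∨ (E ∧ ¬Y).
--   * Reflection (jT, Gen, Q4):  ⊢ (∃x)x:A → A  when x is not free in A;
--     in particular ⊢ X → ¬δ.
--   * Hence δ → X ∨ (E ∧ ¬Y) collapses to δ → E ∧ ¬Y.  So ⊢ δ → E, and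
--     qNec internalises this as ⊢ Y; with ⊢ δ → ¬Y this refutes δ.
--   * qNec internalises ⊢ ¬δ as ⊢ X, and X → δ by the fixed point: ⊢ ⊥.

module Derivations {Ax : Formula → Set} where

  infix 1 ⊢_
  ⊢_ : Formula → Set
  ⊢ A = QLP∅ Ax A

  ∧-projˡ : ∀ {A B} → ⊢ A ∧' B ⇒ A
  ∧-projˡ {A} {B} = taut t
    where
    t : Tautology (A ∧' B ⇒ A)
    t v with eval v A | eval v B
    ... | true  | true  = refl
    ... | true  | false = refl
    ... | false | _     = refl

  ∧-projʳ : ∀ {A B} → ⊢ A ∧' B ⇒ B
  ∧-projʳ {A} {B} = taut t
    where
    t : Tautology (A ∧' B ⇒ B)
    t v with eval v A | eval v B
    ... | true  | true  = refl
    ... | true  | false = refl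
    ... | false | _     = refl

  ∧-elimˡ : ∀ {A B} → ⊢ A ∧' B → ⊢ A
  ∧-elimˡ = mp ∧-projˡ

  ∧-elimʳ : ∀ {A B} → ⊢ A ∧' B → ⊢ B
  ∧-elimʳ = mp ∧-projʳ

  ∨-injˡ : ∀ {A B} → ⊢ A ⇒ A ∨' B
  ∨-injˡ {A} {B} = taut t
    where
    t : Tautology (A ⇒ A ∨' B)
    t v with eval v A
    ... | true  = refl
    ... | false = refl

  compose : ∀ {A B C} → ⊢ A ⇒ B → ⊢ B ⇒ C → ⊢ A ⇒ C
  compose {A} {B} {C} ab bc = mp (mp (taut t) ab) bc
    where
    t : Tautology ((A ⇒ B) ⇒ (B ⇒ C) ⇒ (A ⇒ C))
    t v with eval v A | eval v B | eval v C
    ... | true  | true  | true  = refl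
    ... | true  | true  | false = refl
    ... | true  | false | _     = refl
    ... | false | true  | true  = refl
    ... | false | true  | false = refl
    ... | false | false | _     = refl

  drop-refuting : ∀ {D X C} → ⊢ D ⇒ X ∨' C → ⊢ X ⇒ ¬' D → ⊢ D ⇒ C
  drop-refuting {D} {X} {C} dxc xnd = mp (mp (taut t) dxc) xnd
    where
    t : Tautology ((D ⇒ X ∨' C) ⇒ (X ⇒ ¬' D) ⇒ (D ⇒ C))
    t v with eval v D | eval v X | eval v C
    ... | true  | true  | _     = refl
    ... | true  | false | true  = refl
    ... | true  | false | false = refl
    ... | false | true  | _     = refl
    ... | false | false | _     = refl

  tollens : ∀ {D Y} → ⊢ D ⇒ ¬' Y → ⊢ Y → ⊢ ¬' D
  tollens {D} {Y} dny y = mp (mp (taut t) dny) y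
    where
    t : Tautology ((D ⇒ ¬' Y) ⇒ Y ⇒ ¬' D)
    t v with eval v D | eval v Y
    ... | true  | true  = refl
    ... | true  | false = refl
    ... | false | true  = refl
    ... | false | false = refl

  explosion : ∀ {D} → ⊢ D → ⊢ ¬' D → ⊢ ⊥'
  explosion {D} d nd = mp (mp (taut t) d) nd
    where
    t : Tautology (D ⇒ ¬' D ⇒ ⊥')
    t v with eval v D
    ... | true  = refl
    ... | false = refl

  -- Gen turns the instance x:A → A of jT into (∀x)(x:A → A), and Q4
  -- moves the quantifier to the antecedent as an existential.
  reflection : ∀ {x A} → ¬ Free x A → ⊢ ∃' x (jv x ∶ A) ⇒ A
  reflection x∉A = mp (q4 x∉A) (gen jT)

  FixedPoint : Formula → Formula → Formula → Formula → Formula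
  FixedPoint D X E Y = D ⇔ (X ∨' (E ∧' ¬' Y))

  -- Suppose X behaves like "¬D is provable"
  -- (it implies ¬D, and a proof of ¬D yields one of X) and Y like
  -- "D → E is provable".
  fixedPoint-inconsistent :
    ∀ {D X E Y : Formula} →
    ⊢ FixedPoint D X E Y →
    ⊢ X ⇒ ¬' D → (⊢ ¬' D → ⊢ X) → (⊢ D ⇒ E → ⊢ Y) →
    ⊢ ⊥'
  fixedPoint-inconsistent {D} {X} {E} {Y} fix X→¬D internalise-¬D internalise-D→E =
    explosion ⊢D ⊢¬D
    where
    -- The disjunct X of the fixed point refutes D, so D forces E ∧ ¬Y.
    D→E∧¬Y : ⊢ D ⇒ E ∧' ¬' Y
    D→E∧¬Y = drop-refuting (∧-elimˡ fix) X→¬D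

    ⊢Y : ⊢ Y
    ⊢Y = internalise-D→E (compose D→E∧¬Y ∧-projˡ)

    ⊢¬D : ⊢ ¬' D
    ⊢¬D = tollens (compose D→E∧¬Y ∧-projʳ) ⊢Y

    -- The first disjunct X, now provable, yields D by the fixed point.
    ⊢D : ⊢ D
    ⊢D = mp (compose ∨-injˡ (∧-elimʳ fix)) (internalise-¬D ⊢¬D)

open Derivations

theorem25 : (e : ℕ) → Inconsistent (λ A → A ≡ fixAxiom e)
theorem25 e =
  fixedPoint-inconsistent (ax refl)
    (reflection 0∉¬δ) (qnec 0∉¬δ) (qnec 0∉δ⇒E)
  where
  0∉¬δ : ¬ Free 0 (¬' δ)
  0∉¬δ (neg ())
  0∉δ⇒E : ¬ Free 0 (δ ⇒ pv e)
  0∉δ⇒E (impˡ ())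
  0∉δ⇒E (impʳ ())
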